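{- For each $\star\in\{\sqcup,\uparrow,\downarrow,\updownarrow\}$ and all $P\in\mathcal R_n$, $Q\in\mathcal R_m$ with $n,m\ge1$, $$\Delta_{\mathcal R}(P\star Q)=\sum P_{(1)}\otimes(P_{(2)}\star Q)+\sum(P\star Q_{(1)})\otimes Q_{(2)}-P\otimes Q,$$ where the empty relation acts as a two-sided unit for $\star$.
   Context: $\mathcal R_n$ ($n\ge0$) is the set of reflexive relations on $[n]=\{1,\dots,n\}$; $\mathcal R_0$ consists of the empty relation. For $R\in\mathcal R_n$ and $S=\{s_1<\dots<s_k\}\subseteq[n]$, $R|_S\in\mathcal R_k$ is given by $(i,j)\in R|_S\iff(s_i,s_j)\in R$. $\Delta_{\mathcal R}(R)=\sum_{i=0}^nR|_{[i]}\otimes R|_{\{i+1,\dots,n\}}=\sum R_{(1)}\otimes R_{(2)}$, extended linearly to $\mathbb K[\mathcal R]=\bigoplus_n\mathbb K[\mathcal R_n]$. For $P\in\mathcal R_n$, $Q\in\mathcal R_m$ (relations on $[n+m]$): $P\sqcup Q$ is $P$ together with $\{(i+n,j+n):(i,j)\in Q\}$; $P\uparrow Q=P\sqcup Q\cup\{(i,j):1\le i\le n<j\le n+m\}$; $P\downarrow Q=P\sqcup Q\cup\{(j,i):1\le i\le n<j\le n+m\}$; $P\updownarrow Q=P\uparrow Q\cup P\downarrow Q$. -}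

module Defs where

open import Data.Bool using (Bool; true; false; _∨_)
open import Data.Nat using (ℕ; _+_; _∸_; suc)
import Data.Nat.Properties as ℕP
open import Data.Fin using (Fin; toℕ; inject≤; cast; _↑ʳ_; splitAt)
open import Data.Fin.Properties using (toℕ≤pred[n])
open import Data.Sum using (inj₁; inj₂)
open import Data.Product using (Σ; _×_; _,_; proj₁; proj₂)
import Data.Product.Properties as ΣP
open import Data.Vec using (Vec; tabulate)
import Data.Vec
import Data.Vec.Properties as VP
import Data.Bool.Properties as BP
open import Data.List using (List; []; _∷_; _++_; map; allFin; foldr)
open import Data.Integer using (ℤ; +_; -_) renaming (_+_ to _+ℤ_)
open import Relation.Nullary using (yes; no)
open import Relation.Binary using (DecidableEquality)
open import Relation.Binary.PropositionalEquality using (_≡_)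

Rel : ℕ → Set
Rel n = Fin n → Fin n → Bool

-- R ∈ 𝓡_n : the relation is reflexive.
Reflexive : ∀ {n} → Rel n → Set
Reflexive {n} R = (i : Fin n) → R i i ≡ true

-- Restriction R|_S, where S = {s_1 < … < s_k} is given by the
-- increasing map s : Fin k → Fin n.
restrict : ∀ {n k} → Rel n → (Fin k → Fin n) → Rel k
restrict R s i j = R (s i) (s j)

-- Basis elements of 𝕂[𝓡] = ⊕_n 𝕂[𝓡_n]: a size together with the relation,
-- stored as a Boolean matrix (so that equality is decidable).

Basis : Set
Basis = Σ ℕ (λ n → Vec (Vec Bool n) n)

⌜_⌝ : ∀ {n} → Rel n → Basis
⌜_⌝ {n} R = n , tabulate (λ i → tabulate (λ j → R i j))

_≟B_ : DecidableEquality Basis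
_≟B_ = ΣP.≡-dec ℕP._≟_ (VP.≡-dec (VP.≡-dec BP._≟_))

-- Formal ℤ-linear combinations of pairs of basis elements, i.e. elements
-- of 𝕂[𝓡] ⊗ 𝕂[𝓡] (with 𝕂 = ℤ), and their coefficient functions.

Tensor : Set
Tensor = List (ℤ × (Basis × Basis))

coeff : Tensor → Basis → Basis → ℤ
coeff t A B = foldr step (+ 0) t
  where
  step : ℤ × (Basis × Basis) → ℤ → ℤ
  step (c , (X , Y)) acc with X ≟B A | Y ≟B B
  ... | yes _ | yes _ = c +ℤ acc
  ... | _     | _     = acc

-- The coproduct Δ_𝓡(R) = Σ_{i=0}^n R|_[i] ⊗ R|_{i+1,…,n}, as the list of
-- its summands (R_(1) , R_(2)) (each with coefficient 1).

cutLeft : ∀ {n} → Rel n → (i : Fin (suc n)) → Rel (toℕ i)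
cutLeft R i = restrict R (λ a → inject≤ a (toℕ≤pred[n] i))

cutRight : ∀ {n} → Rel n → (i : Fin (suc n)) → Rel (_∸_ _ (toℕ i))
cutRight {n} R i =
  restrict R (λ a → cast (ℕP.m+[n∸m]≡n (toℕ≤pred[n] i)) (toℕ i ↑ʳ a))

ΔSummands : ∀ {n} → Rel n → List (Basis × Basis)
ΔSummands R = map (λ i → ⌜ cutLeft R i ⌝ , ⌜ cutRight R i ⌝) (allFin _)

Δ : ∀ {n} → Rel n → Tensor
Δ R = map (λ p → (+ 1 , p)) (ΔSummands R)

data Op : Set where
  ⊔ ↑ ↓ ↕ : Op

-- whether pairs (i , j) with i ≤ n < j (resp. (j , i)) are added
upFlag downFlag : Op → Bool
upFlag ⊔ = false
upFlag ↑ = true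
upFlag ↓ = false
upFlag ↕ = true
downFlag ⊔ = false
downFlag ↑ = false
downFlag ↓ = true
downFlag ↕ = true

prod : Op → ∀ {n m} → Rel n → Rel m → Rel (n + m)
prod ⋆ {n} P Q a b with splitAt n a | splitAt n b
... | inj₁ i | inj₁ j = P i j
... | inj₂ i | inj₂ j = Q i j
... | inj₁ _ | inj₂ _ = upFlag ⋆
... | inj₂ _ | inj₁ _ = downFlag ⋆

relOf : (X : Basis) → Rel (proj₁ X)
relOf (n , M) i j = Data.Vec.lookup (Data.Vec.lookup M i) j

prodB : Op → Basis → Basis → Basis
prodB ⋆ X Y = ⌜ prod ⋆ (relOf X) (relOf Y) ⌝

rhs : Op → ∀ {n m} → Rel n → Rel m → Tensor
rhs ⋆ P Q =
  map (λ { (X , Y) → (+ 1 , (X , prodB ⋆ Y ⌜ Q ⌝)) }) (ΔSummands P)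
  ++ map (λ { (X , Y) → (+ 1 , (prodB ⋆ ⌜ P ⌝ X , Y)) }) (ΔSummands Q)
  ++ ((- (+ 1)) , (⌜ P ⌝ , ⌜ Q ⌝)) ∷ []

-- A cut of P ⋆ Q at a position i ≤ n splits it as P|[i] ⊗ (P|{i+1,…,n} ⋆ Q), and a cut at n + 1 + j
-- as (P ⋆ Q|[j+1]) ⊗ Q|{j+2,…,m}: inside the diagonal blocks of P and of Q the product P ⋆ Q has the
-- entries of P and Q, and outside them entries depending on ⋆ alone.  So Δ(P ⋆ Q) is the first sum
-- plus the second sum without the term (P ⋆ ∅) ⊗ Q = P ⊗ Q of the cut of Q at 0, which −P ⊗ Q removes.

module Submission where

open import Defs
open import Data.Nat using (ℕ; _≥_; zero; suc; _+_; _∸_; _<_; _≤_)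
open import Data.Nat.Properties
  using (+-cancelˡ-≡; +-assoc; +-suc; +-identityʳ; +-∸-comm; m+[n∸m]≡n; [m+n]∸[m+o]≡n∸o; m≤m+n; +-monoʳ-<; +-cancelˡ-<; <⇒≱)
import Data.Fin as Fin
open import Data.Fin using (Fin; toℕ; splitAt; _↑ˡ_; _↑ʳ_)
open import Data.Fin.Properties
  using (toℕ-injective; toℕ-↑ˡ; toℕ-↑ʳ; toℕ-cast; toℕ-inject≤; toℕ<n; toℕ≤pred[n]; splitAt-↑ˡ; splitAt-↑ʳ; splitAt⁻¹-↑ˡ; splitAt⁻¹-↑ʳ)
open import Data.Sum using (inj₁; inj₂)
open import Data.Sum.Relation.Binary.Pointwise using (Pointwise; inj₁; inj₂)
open import Data.Product using (_×_; _,_)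
open import Data.List using (List; []; _∷_; _++_; map; tabulate)
open import Data.List.Properties using (map-tabulate; map-++; tabulate-cong)
import Data.Vec as Vec
import Data.Vec.Properties as Vec
import Data.Integer as ℤ
open ℤ using (ℤ)
import Data.Integer.Properties as ℤ
open import Data.Integer.Tactic.RingSolver using (solve-∀)
open import Data.Empty using (⊥-elim)
open import Relation.Nullary using (yes; no)
open import Relation.Binary.PropositionalEquality
  using (_≡_; refl; sym; trans; cong; cong₂; subst; subst₂; module ≡-Reasoning)
open import Function using (_∘_)

-- R′ is the diagonal block of R starting at position d.  Positions are compared through toℕ,
-- so R and R′ may have any sizes.
BlockAt : ∀ {a b} → ℕ → Rel a → Rel b → Set
BlockAt d R R' = ∀ {x y x' y'} → toℕ x ≡ d + toℕ x' → toℕ y ≡ d + toℕ y' → R x y ≡ R' x' y'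

block-refl : ∀ {a} (R : Rel a) → BlockAt 0 R R
block-refl R ex ey = cong₂ R (toℕ-injective ex) (toℕ-injective ey)

⌜⌝-cong : ∀ {a b} {R : Rel a} {R' : Rel b} → a ≡ b → BlockAt 0 R R' → ⌜ R ⌝ ≡ ⌜ R' ⌝
⌜⌝-cong {a} refl blk = cong (a ,_) (Vec.tabulate-cong λ _ → Vec.tabulate-cong λ _ → blk refl refl)

Shifts : ∀ {a b} → ℕ → (Fin a → Fin b) → Set
Shifts d s = ∀ x → toℕ (s x) ≡ d + toℕ x

restrict-host : ∀ {a b c d} {R : Rel b} {R' : Rel c} {s : Fin a → Fin b} →
                Shifts d s → BlockAt d R R' → BlockAt 0 (restrict R s) R'
restrict-host {d = d} {s = s} shift blk {x} {y} ex ey =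
  blk (trans (shift x) (cong (d +_) ex)) (trans (shift y) (cong (d +_) ey))

restrict-block : ∀ {a b c d e} {R : Rel a} {R' : Rel b} {s : Fin c → Fin b} →
                 BlockAt d R R' → Shifts e s → BlockAt (d + e) R (restrict R' s)
restrict-block {d = d} {e} blk shift {x' = x'} {y' = y'} ex ey =
  blk (trans ex (trans (+-assoc d e _) (cong (d +_) (sym (shift x')))))
      (trans ey (trans (+-assoc d e _) (cong (d +_) (sym (shift y')))))

cutLeft-block : ∀ {a n} {R : Rel a} {R' : Rel n} i → BlockAt 0 R R' → BlockAt 0 R (cutLeft R' i)
cutLeft-block i blk = restrict-block {d = 0} {e = 0} blk (λ a → toℕ-inject≤ a _)

cutRight-block : ∀ {a n d} {R : Rel a} {R' : Rel n} i → BlockAt d R R' → BlockAt (d + toℕ i) R (cutRight R' i)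
cutRight-block i blk = restrict-block blk (λ a → trans (toℕ-cast _ _) (toℕ-↑ʳ (toℕ i) a))

cutLeft-host : ∀ {n b} {R : Rel n} {R' : Rel b} i → BlockAt 0 R R' → BlockAt 0 (cutLeft R i) R'
cutLeft-host i = restrict-host {d = 0} (λ a → toℕ-inject≤ a _)

cutRight-host : ∀ {n b d} {R : Rel n} {R' : Rel b} i → toℕ i ≡ d → BlockAt d R R' → BlockAt 0 (cutRight R i) R'
cutRight-host {d = d} i refl = restrict-host {d = d} (λ a → trans (toℕ-cast _ _) (toℕ-↑ʳ (toℕ i) a))

relOf-block : ∀ {a} (R : Rel a) → BlockAt 0 (relOf ⌜ R ⌝) R
relOf-block R {x} {y} ex ey = trans (relOf-⌜⌝ x y) (block-refl R ex ey)
  where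
  relOf-⌜⌝ : ∀ i j → relOf ⌜ R ⌝ i j ≡ R i j
  relOf-⌜⌝ i j = trans (cong (λ row → Vec.lookup row j) (Vec.lookup∘tabulate _ i)) (Vec.lookup∘tabulate _ j)

toℕ-splitAtˡ : ∀ n {m} {x : Fin (n + m)} {i} → splitAt n x ≡ inj₁ i → toℕ x ≡ toℕ i
toℕ-splitAtˡ n {m} {i = i} eq = trans (cong toℕ (sym (splitAt⁻¹-↑ˡ eq))) (toℕ-↑ˡ i m)

toℕ-splitAtʳ : ∀ n {m} {x : Fin (n + m)} {j} → splitAt n x ≡ inj₂ j → toℕ x ≡ n + toℕ j
toℕ-splitAtʳ n {j = j} eq = trans (cong toℕ (sym (splitAt⁻¹-↑ʳ eq))) (toℕ-↑ʳ n j)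

splitAt-block : ∀ d {n m n' m'} {x : Fin (n + m)} {x' : Fin (n' + m')} → n ≡ d + n' → toℕ x ≡ d + toℕ x' →
                Pointwise (λ i i' → toℕ i ≡ d + toℕ i') (λ j j' → toℕ j ≡ toℕ j') (splitAt n x) (splitAt n' x')
splitAt-block d {n} {n' = n'} {x = x} {x'} hn ex with splitAt n x in eq | splitAt n' x' in eq'
... | inj₁ i | inj₁ i' = inj₁ (trans (sym (toℕ-splitAtˡ n eq)) (trans ex (cong (d +_) (toℕ-splitAtˡ n' eq'))))
... | inj₂ j | inj₂ j' = inj₂ (+-cancelˡ-≡ n _ _ (begin
  n + toℕ j          ≡⟨ sym (toℕ-splitAtʳ n eq) ⟩
  toℕ x              ≡⟨ ex ⟩
  d + toℕ x'         ≡⟨ cong (d +_) (toℕ-splitAtʳ n' eq') ⟩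
  d + (n' + toℕ j')  ≡⟨ sym (+-assoc d n' _) ⟩
  d + n' + toℕ j'    ≡⟨ cong (_+ toℕ j') (sym hn) ⟩
  n + toℕ j'         ∎))
  where open ≡-Reasoning
... | inj₁ i | inj₂ j' = ⊥-elim (<⇒≱ (+-cancelˡ-< d _ _ (subst₂ _<_ ex hn x<n)) n'≤x')
  where
  x<n : toℕ x < n
  x<n = subst (_< n) (sym (toℕ-splitAtˡ n eq)) (toℕ<n i)
  n'≤x' : n' ≤ toℕ x'
  n'≤x' = subst (n' ≤_) (sym (toℕ-splitAtʳ n' eq')) (m≤m+n n' (toℕ j'))
... | inj₂ j | inj₁ i' = ⊥-elim (<⇒≱ (+-monoʳ-< d x'<n') (subst₂ _≤_ hn ex n≤x))
  where
  x'<n' : toℕ x' < n'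
  x'<n' = subst (_< n') (sym (toℕ-splitAtˡ n' eq')) (toℕ<n i')
  n≤x : n ≤ toℕ x
  n≤x = subst (n ≤_) (sym (toℕ-splitAtʳ n eq)) (m≤m+n n (toℕ j))

ones : List (Basis × Basis) → Tensor
ones = map (ℤ.+ 1 ,_)

cutRight-zero : ∀ {n} (R : Rel n) → ⌜ cutRight R Fin.zero ⌝ ≡ ⌜ R ⌝
cutRight-zero R = ⌜⌝-cong refl (cutRight-host Fin.zero refl (block-refl R))

cuts : ∀ {n} → Rel n → Fin (suc n) → Basis × Basis
cuts R i = ⌜ cutLeft R i ⌝ , ⌜ cutRight R i ⌝

map-ΔSummands : ∀ {C : Set} {n} (R : Rel n) {f : Basis × Basis → C} → map f (ΔSummands R) ≡ tabulate (f ∘ cuts R)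
map-ΔSummands R {f} = trans (cong (map f) (map-tabulate (λ i → i) (cuts R))) (map-tabulate (cuts R) f)

tabulate-+ : ∀ {A : Set} a b (f : Fin (a + b) → A) → tabulate f ≡ tabulate (f ∘ (_↑ˡ b)) ++ tabulate (f ∘ (a ↑ʳ_))
tabulate-+ zero    b f = refl
tabulate-+ (suc a) b f = cong (f Fin.zero ∷_) (tabulate-+ a b (f ∘ Fin.suc))

toℕ-suc-↑ʳ : ∀ {n m} (j : Fin m) → toℕ (suc n ↑ʳ j) ≡ n + toℕ (Fin.suc j)
toℕ-suc-↑ʳ {n} j = trans (toℕ-↑ʳ (suc n) j) (sym (+-suc n (toℕ j)))

module _ (⋆ : Op) where

  prod-block : ∀ d {n m n' m'} {P : Rel n} {Q : Rel m} {P' : Rel n'} {Q' : Rel m'} →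
               n ≡ d + n' → BlockAt d P P' → BlockAt 0 Q Q' → BlockAt d (prod ⋆ P Q) (prod ⋆ P' Q')
  prod-block d {n} {n' = n'} hn hP hQ {x} {y} {x'} {y'} ex ey
    with splitAt n x | splitAt n' x' | splitAt-block d hn ex | splitAt n y | splitAt n' y' | splitAt-block d hn ey
  ... | _ | _ | inj₁ ex₁ | _ | _ | inj₁ ey₁ = hP ex₁ ey₁
  ... | _ | _ | inj₁ _   | _ | _ | inj₂ _   = refl
  ... | _ | _ | inj₂ _   | _ | _ | inj₁ _   = refl
  ... | _ | _ | inj₂ ex₂ | _ | _ | inj₂ ey₂ = hQ ex₂ ey₂

  module _ {n m : ℕ} (P : Rel n) (Q : Rel m) where

    prod-blockˡ : BlockAt 0 (prod ⋆ P Q) P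
    prod-blockˡ {x} {y} {i} {j} ex ey = begin
      prod ⋆ P Q x y                ≡⟨ cong₂ (prod ⋆ P Q) (toℕ-injective (trans ex (sym (toℕ-↑ˡ i m))))
                                                          (toℕ-injective (trans ey (sym (toℕ-↑ˡ j m)))) ⟩
      prod ⋆ P Q (i ↑ˡ m) (j ↑ˡ m)  ≡⟨ prod-↑ˡ ⟩
      P i j                         ∎
      where
      open ≡-Reasoning
      prod-↑ˡ : prod ⋆ P Q (i ↑ˡ m) (j ↑ˡ m) ≡ P i j
      prod-↑ˡ rewrite splitAt-↑ˡ n i m | splitAt-↑ˡ n j m = refl

    prod-blockʳ : BlockAt n (prod ⋆ P Q) Q
    prod-blockʳ {x} {y} {i} {j} ex ey = begin
      prod ⋆ P Q x y                ≡⟨ cong₂ (prod ⋆ P Q) (toℕ-injective (trans ex (sym (toℕ-↑ʳ n i))))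
                                                          (toℕ-injective (trans ey (sym (toℕ-↑ʳ n j)))) ⟩
      prod ⋆ P Q (n ↑ʳ i) (n ↑ʳ j)  ≡⟨ prod-↑ʳ ⟩
      Q i j                         ∎
      where
      open ≡-Reasoning
      prod-↑ʳ : prod ⋆ P Q (n ↑ʳ i) (n ↑ʳ j) ≡ Q i j
      prod-↑ʳ rewrite splitAt-↑ʳ n m i | splitAt-↑ʳ n m j = refl

    prodB-⌜⌝ : prodB ⋆ ⌜ P ⌝ ⌜ Q ⌝ ≡ ⌜ prod ⋆ P Q ⌝
    prodB-⌜⌝ = ⌜⌝-cong refl (prod-block 0 refl (relOf-block P) (relOf-block Q))

  prod-identityʳ : ∀ {n} (P : Rel n) (E : Rel 0) → ⌜ prod ⋆ P E ⌝ ≡ ⌜ P ⌝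
  prod-identityʳ {n} P E = ⌜⌝-cong (+-identityʳ n) (prod-blockˡ P E)

  module _ {n m : ℕ} (P : Rel n) (Q : Rel m) where

    cutLeft-prod-↑ˡ : (i : Fin (suc n)) → ⌜ cutLeft (prod ⋆ P Q) (i ↑ˡ m) ⌝ ≡ ⌜ cutLeft P i ⌝
    cutLeft-prod-↑ˡ i = ⌜⌝-cong (toℕ-↑ˡ i m) (cutLeft-host (i ↑ˡ m) (cutLeft-block i (prod-blockˡ P Q)))

    cutRight-prod-↑ˡ : (i : Fin (suc n)) → ⌜ cutRight (prod ⋆ P Q) (i ↑ˡ m) ⌝ ≡ prodB ⋆ ⌜ cutRight P i ⌝ ⌜ Q ⌝
    cutRight-prod-↑ˡ i = trans
      (⌜⌝-cong size (cutRight-host (i ↑ˡ m) (toℕ-↑ˡ i m)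
        (prod-block (toℕ i) (sym (m+[n∸m]≡n i≤n)) (cutRight-block {d = 0} i (block-refl P)) (block-refl Q))))
      (sym (prodB-⌜⌝ (cutRight P i) Q))
      where
      i≤n : toℕ i ≤ n
      i≤n = toℕ≤pred[n] i
      size : n + m ∸ toℕ (i ↑ˡ m) ≡ n ∸ toℕ i + m
      size = trans (cong (n + m ∸_) (toℕ-↑ˡ i m)) (+-∸-comm m i≤n)

    cutLeft-prod-↑ʳ : (j : Fin m) → ⌜ cutLeft (prod ⋆ P Q) (suc n ↑ʳ j) ⌝ ≡ prodB ⋆ ⌜ P ⌝ ⌜ cutLeft Q (Fin.suc j) ⌝
    cutLeft-prod-↑ʳ j = trans
      (⌜⌝-cong (toℕ-suc-↑ʳ j) (cutLeft-host (suc n ↑ʳ j)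
        (prod-block 0 refl (block-refl P) (cutLeft-block (Fin.suc j) (block-refl Q)))))
      (sym (prodB-⌜⌝ P (cutLeft Q (Fin.suc j))))

    cutRight-prod-↑ʳ : (j : Fin m) → ⌜ cutRight (prod ⋆ P Q) (suc n ↑ʳ j) ⌝ ≡ ⌜ cutRight Q (Fin.suc j) ⌝
    cutRight-prod-↑ʳ j = ⌜⌝-cong size (cutRight-host (suc n ↑ʳ j) (toℕ-suc-↑ʳ j) (cutRight-block (Fin.suc j) (prod-blockʳ P Q)))
      where
      size : n + m ∸ toℕ (suc n ↑ʳ j) ≡ m ∸ suc (toℕ j)
      size = trans (cong (n + m ∸_) (toℕ-suc-↑ʳ j)) ([m+n]∸[m+o]≡n∸o n m _)

    leftSummand : Fin (suc n) → Basis × Basis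
    leftSummand i = ⌜ cutLeft P i ⌝ , prodB ⋆ ⌜ cutRight P i ⌝ ⌜ Q ⌝

    rightSummand : Fin m → Basis × Basis
    rightSummand j = prodB ⋆ ⌜ P ⌝ ⌜ cutLeft Q (Fin.suc j) ⌝ , ⌜ cutRight Q (Fin.suc j) ⌝

    ΔSummands-prod : ΔSummands (prod ⋆ P Q) ≡ tabulate leftSummand ++ tabulate rightSummand
    ΔSummands-prod = begin
      ΔSummands (prod ⋆ P Q)                   ≡⟨ map-tabulate (λ i → i) (cuts (prod ⋆ P Q)) ⟩
      tabulate (cuts (prod ⋆ P Q))             ≡⟨ tabulate-+ (suc n) m (cuts (prod ⋆ P Q)) ⟩
      tabulate (cuts (prod ⋆ P Q) ∘ (_↑ˡ m)) ++ tabulate (cuts (prod ⋆ P Q) ∘ (suc n ↑ʳ_))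
        ≡⟨ cong₂ _++_ (tabulate-cong λ i → cong₂ _,_ (cutLeft-prod-↑ˡ i) (cutRight-prod-↑ˡ i))
                      (tabulate-cong λ j → cong₂ _,_ (cutLeft-prod-↑ʳ j) (cutRight-prod-↑ʳ j)) ⟩
      tabulate leftSummand ++ tabulate rightSummand ∎
      where open ≡-Reasoning

    Δ-prod : Δ (prod ⋆ P Q) ≡ ones (tabulate leftSummand) ++ ones (tabulate rightSummand)
    Δ-prod = trans (cong ones ΔSummands-prod) (map-++ _ (tabulate leftSummand) (tabulate rightSummand))

    rhs-split : rhs ⋆ P Q ≡ ones (tabulate leftSummand) ++ (ℤ.+ 1 , (⌜ P ⌝ , ⌜ Q ⌝)) ∷ ones (tabulate rightSummand)
                                                        ++ (ℤ.- ℤ.+ 1 , (⌜ P ⌝ , ⌜ Q ⌝)) ∷ []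
    rhs-split = cong₂ _++_
      (trans (map-ΔSummands P) (sym (map-tabulate leftSummand (ℤ.+ 1 ,_))))
      (cong (_++ (ℤ.- ℤ.+ 1 , (⌜ P ⌝ , ⌜ Q ⌝)) ∷ [])
        (trans (map-ΔSummands Q)
               (cong₂ _∷_ (cong (ℤ.+ 1 ,_) (cong₂ _,_ P⋆∅≡P (cutRight-zero Q)))
                          (sym (map-tabulate rightSummand (ℤ.+ 1 ,_))))))
      where
      P⋆∅≡P : prodB ⋆ ⌜ P ⌝ ⌜ cutLeft Q Fin.zero ⌝ ≡ ⌜ P ⌝
      P⋆∅≡P = trans (prodB-⌜⌝ P (cutLeft Q Fin.zero)) (prod-identityʳ P (cutLeft Q Fin.zero))

termCoeff : ℤ × (Basis × Basis) → Basis → Basis → ℤ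
termCoeff (c , (X , Y)) A B with X ≟B A | Y ≟B B
... | yes _ | yes _ = c
... | _     | _     = ℤ.+ 0

coeff-∷ : ∀ t ts A B → coeff (t ∷ ts) A B ≡ termCoeff t A B ℤ.+ coeff ts A B
coeff-∷ (c , (X , Y)) ts A B with X ≟B A | Y ≟B B
... | yes _ | yes _ = refl
... | yes _ | no _  = sym (ℤ.+-identityˡ _)
... | no _  | _     = sym (ℤ.+-identityˡ _)

termCoeff-neg : ∀ c p A B → termCoeff (ℤ.- c , p) A B ≡ ℤ.- termCoeff (c , p) A B
termCoeff-neg c (X , Y) A B with X ≟B A | Y ≟B B
... | yes _ | yes _ = refl
... | yes _ | no _  = refl
... | no _  | _     = refl

coeff-++ : ∀ xs ys A B → coeff (xs ++ ys) A B ≡ coeff xs A B ℤ.+ coeff ys A B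
coeff-++ []       ys A B = sym (ℤ.+-identityˡ _)
coeff-++ (t ∷ xs) ys A B = begin
  coeff (t ∷ xs ++ ys) A B                                 ≡⟨ coeff-∷ t (xs ++ ys) A B ⟩
  termCoeff t A B ℤ.+ coeff (xs ++ ys) A B                 ≡⟨ cong (λ l → termCoeff t A B ℤ.+ l) (coeff-++ xs ys A B) ⟩
  termCoeff t A B ℤ.+ (coeff xs A B ℤ.+ coeff ys A B)      ≡⟨ sym (ℤ.+-assoc (termCoeff t A B) _ _) ⟩
  (termCoeff t A B ℤ.+ coeff xs A B) ℤ.+ coeff ys A B      ≡⟨ cong (λ l → l ℤ.+ coeff ys A B) (sym (coeff-∷ t xs A B)) ⟩
  coeff (t ∷ xs) A B ℤ.+ coeff ys A B                      ∎
  where open ≡-Reasoning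

coeff-cancel : ∀ xs c p ys A B → coeff (xs ++ (c , p) ∷ ys ++ (ℤ.- c , p) ∷ []) A B ≡ coeff (xs ++ ys) A B
coeff-cancel xs c p ys A B = begin
  coeff (xs ++ (c , p) ∷ ys ++ (ℤ.- c , p) ∷ []) A B                 ≡⟨ coeff-++ xs _ A B ⟩
  a ℤ.+ coeff ((c , p) ∷ ys ++ (ℤ.- c , p) ∷ []) A B                 ≡⟨ cong (λ l → a ℤ.+ l) (coeff-∷ (c , p) (ys ++ (ℤ.- c , p) ∷ []) A B) ⟩
  a ℤ.+ (k ℤ.+ coeff (ys ++ (ℤ.- c , p) ∷ []) A B)                   ≡⟨ cong (λ l → a ℤ.+ (k ℤ.+ l)) (coeff-++ ys ((ℤ.- c , p) ∷ []) A B) ⟩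
  a ℤ.+ (k ℤ.+ (b ℤ.+ coeff ((ℤ.- c , p) ∷ []) A B))                 ≡⟨ cong (λ l → a ℤ.+ (k ℤ.+ (b ℤ.+ l))) (coeff-∷ (ℤ.- c , p) [] A B) ⟩
  a ℤ.+ (k ℤ.+ (b ℤ.+ (termCoeff (ℤ.- c , p) A B ℤ.+ ℤ.+ 0)))        ≡⟨ cong (λ l → a ℤ.+ (k ℤ.+ (b ℤ.+ (l ℤ.+ ℤ.+ 0)))) (termCoeff-neg c p A B) ⟩
  a ℤ.+ (k ℤ.+ (b ℤ.+ (ℤ.- k ℤ.+ ℤ.+ 0)))                            ≡⟨ cancel a k b ⟩
  a ℤ.+ b                                                            ≡⟨ sym (coeff-++ xs ys A B) ⟩
  coeff (xs ++ ys) A B                                               ∎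
  where
  open ≡-Reasoning
  a = coeff xs A B
  b = coeff ys A B
  k = termCoeff (c , p) A B
  cancel : ∀ a k b → a ℤ.+ (k ℤ.+ (b ℤ.+ (ℤ.- k ℤ.+ ℤ.+ 0))) ≡ a ℤ.+ b
  cancel = solve-∀

lemma4p4 : (⋆ : Op) (n m : ℕ) (P : Rel n) (Q : Rel m) → Reflexive P → Reflexive Q → n ≥ 1 → m ≥ 1 → (A B : Basis) → coeff (Δ (prod ⋆ P Q)) A B ≡ coeff (rhs ⋆ P Q) A B
lemma4p4 ⋆ n m P Q _ _ _ _ A B = begin
  coeff (Δ (prod ⋆ P Q)) A B                                     ≡⟨ cong (λ t → coeff t A B) (Δ-prod ⋆ P Q) ⟩
  coeff (left ++ right) A B                                      ≡⟨ sym (coeff-cancel left (ℤ.+ 1) (⌜ P ⌝ , ⌜ Q ⌝) right A B) ⟩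
  coeff (left ++ (ℤ.+ 1 , (⌜ P ⌝ , ⌜ Q ⌝)) ∷ right ++ (ℤ.- ℤ.+ 1 , (⌜ P ⌝ , ⌜ Q ⌝)) ∷ []) A B
                                                                 ≡⟨ cong (λ t → coeff t A B) (sym (rhs-split ⋆ P Q)) ⟩
  coeff (rhs ⋆ P Q) A B                                          ∎
  where
  open ≡-Reasoning
  left right : Tensor
  left  = ones (tabulate (leftSummand ⋆ P Q))
  right = ones (tabulate (rightSummand ⋆ P Q))
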